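{- There is a Threshold-of-ANDs circuit computing the parity function $\mathrm{Par}(x_1,\ldots,x_n) = \sum_i x_i \bmod 2$ on $\{0,1\}^n$ of size $O(5^{n/3})$.
   Context: A Threshold-of-ANDs circuit on Boolean inputs $x_1,\ldots,x_n$ consists of AND gates $g_1,\ldots,g_s$, each computing the conjunction of a set of literals from $\{x_1,\ldots,x_n,\neg x_1,\ldots,\neg x_n\}$, feeding a single top threshold gate with real weights $w_0,w_1,\ldots,w_s$: the circuit outputs $1$ if $w_0 + \sum_t w_t g_t(x) < 0$ and $0$ if $w_0 + \sum_t w_t g_t(x) > 0$, where this quantity must be nonzero for every $x \in \{0,1\}^n$. The size of the circuit is the number $s$ of AND gates. -}

module Defs where

open import Data.Nat using (ℕ; zero; suc)
open import Data.Fin using (Fin; zero; suc)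
open import Data.Bool using (Bool; true; false; _xor_; not; _∧_)
open import Data.Product using (_×_; _,_)
open import Data.List using (List; []; _∷_)
open import Data.Rational using (ℚ; 0ℚ; 1ℚ; _+_; _*_; _<_)
open import Relation.Binary.PropositionalEquality using (_≡_)

Input : ℕ → Set
Input n = Fin n → Bool

Literal : ℕ → Set
Literal n = Fin n × Bool

evalLit : ∀ {n} → Literal n → Input n → Bool
evalLit (i , true)  x = x i
evalLit (i , false) x = not (x i)

AndGate : ℕ → Set
AndGate n = List (Literal n)

evalAnd : ∀ {n} → AndGate n → Input n → Bool
evalAnd []      x = true
evalAnd (l ∷ g) x = evalLit l x ∧ evalAnd g x

b2q : Bool → ℚ
b2q true  = 1ℚ
b2q false = 0ℚ

sumFin : ∀ s → (Fin s → ℚ) → ℚ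
sumFin zero    f = 0ℚ
sumFin (suc s) f = f zero + sumFin s (λ t → f (suc t))

record ThrAnd (n : ℕ) : Set where
  field
    size  : ℕ
    gates : Fin size → AndGate n
    w0    : ℚ
    w     : Fin size → ℚ

open ThrAnd public

linForm : ∀ {n} → ThrAnd n → Input n → ℚ
linForm C x = w0 C + sumFin (size C) (λ t → w C t * b2q (evalAnd (gates C t) x))

Computes : ∀ {n} → ThrAnd n → (Input n → Bool) → Set
Computes {n} C f = (x : Input n) →
  ((f x ≡ true → linForm C x < 0ℚ) × (f x ≡ false → 0ℚ < linForm C x))

parity : ∀ n → Input n → Bool
parity zero    x = false
parity (suc n) x = x zero xor parity n (λ i → x (suc i))

{-# OPTIONS --safe #-}
-- With parity encoded as the sign (−1)^Par, the parity of a concatenation is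
-- the product of the parities of the pieces, and a product of sums of ANDs over
-- disjoint variables is again a sum of ANDs whose number of terms is the
-- product of the numbers of terms.  On three bits
--   (−1)^(x₀ ⊕ x₁ ⊕ x₂) = 1 − 2·[x₀ ⊕ x₁ ⊕ x₂ = 1],
-- and the four odd inputs are four mutually exclusive minterms, so five ANDs
-- suffice.  Blocks of three therefore give a sum of at most 4·5^⌊n/3⌋ ANDs
-- equal to (−1)^Par, and a threshold gate with w₀ = 0 reads off its sign.
module Submission where

open import Defs
open import Data.Nat using (ℕ; _≤_; _*_; _^_; _/_)
open import Data.Product using (Σ; _×_)

open import Algebra using (CommutativeMonoid)
open import Data.Bool using (Bool; true; false; _xor_; _∧_)
open import Data.Bool.Properties using (∧-assoc; xor-assoc)
open import Data.Fin using (Fin; zero; suc; _↑ˡ_; _↑ʳ_)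
open import Data.Integer using (+_)
open import Data.List using (List; []; _∷_; map; _++_; length; lookup; cartesianProductWith)
open import Data.List.Properties using (length-map; length-++)
open import Data.Nat using (_+_; z≤n; s≤s)
import Data.Nat.Properties as ℕ
open import Data.Nat.DivMod using (m/n≡1+[m∸n]/n)
open import Data.Product using (_,_; proj₁; proj₂; map₁; map₂)
open import Data.Rational using (ℚ; 0ℚ; 1ℚ)
import Data.Rational as ℚ
import Data.Rational.Properties as ℚ
open import Function using (_∘_)
open import Relation.Binary.PropositionalEquality

open import Algebra.Properties.CommutativeSemigroup
  (CommutativeMonoid.commutativeSemigroup ℚ.*-1-commutativeMonoid) using (interchange)

length-cartesianProductWith : ∀ {a b c} {A : Set a} {B : Set b} {C : Set c}
  (f : A → B → C) (xs : List A) (ys : List B) →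
  length (cartesianProductWith f xs ys) ≡ length xs * length ys
length-cartesianProductWith f []       ys = refl
length-cartesianProductWith f (x ∷ xs) ys = begin
  length (map (f x) ys ++ cartesianProductWith f xs ys)
    ≡⟨ length-++ (map (f x) ys) ⟩
  length (map (f x) ys) + length (cartesianProductWith f xs ys)
    ≡⟨ cong₂ _+_ (length-map (f x) ys) (length-cartesianProductWith f xs ys) ⟩
  length ys + length xs * length ys ∎
  where open ≡-Reasoning

b2q-∧ : ∀ p q → b2q (p ∧ q) ≡ b2q p ℚ.* b2q q
b2q-∧ true  q = sym (ℚ.*-identityˡ (b2q q))
b2q-∧ false q = sym (ℚ.*-zeroˡ (b2q q))

evalAnd-++ : ∀ {n} (g h : AndGate n) x → evalAnd (g ++ h) x ≡ evalAnd g x ∧ evalAnd h x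
evalAnd-++ []      h x = refl
evalAnd-++ (l ∷ g) h x = begin
  evalLit l x ∧ evalAnd (g ++ h) x          ≡⟨ cong (evalLit l x ∧_) (evalAnd-++ g h x) ⟩
  evalLit l x ∧ (evalAnd g x ∧ evalAnd h x) ≡⟨ sym (∧-assoc (evalLit l x) _ _) ⟩
  (evalLit l x ∧ evalAnd g x) ∧ evalAnd h x ∎
  where open ≡-Reasoning

renameGate : ∀ {m n} → (Fin m → Fin n) → AndGate m → AndGate n
renameGate ρ = map (map₁ ρ)

evalLit-map₁ : ∀ {m n} (ρ : Fin m → Fin n) l x → evalLit (map₁ ρ l) x ≡ evalLit l (x ∘ ρ)
evalLit-map₁ ρ (i , true)  x = refl
evalLit-map₁ ρ (i , false) x = refl

evalAnd-renameGate : ∀ {m n} (ρ : Fin m → Fin n) g x →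
  evalAnd (renameGate ρ g) x ≡ evalAnd g (x ∘ ρ)
evalAnd-renameGate ρ []      x = refl
evalAnd-renameGate ρ (l ∷ g) x =
  cong₂ _∧_ (evalLit-map₁ ρ l x) (evalAnd-renameGate ρ g x)

Term : ℕ → Set
Term n = ℚ × AndGate n

-- The linear form Σ wₜ gₜ(x) of a Threshold-of-ANDs circuit without its constant term.
AndSum : ℕ → Set
AndSum n = List (Term n)

evalTerm : ∀ {n} → Term n → Input n → ℚ
evalTerm t x = proj₁ t ℚ.* b2q (evalAnd (proj₂ t) x)

⟦_⟧ : ∀ {n} → AndSum n → Input n → ℚ
⟦ []    ⟧ x = 0ℚ
⟦ t ∷ p ⟧ x = evalTerm t x ℚ.+ ⟦ p ⟧ x

⟦⟧-++ : ∀ {n} (p q : AndSum n) x → ⟦ p ++ q ⟧ x ≡ ⟦ p ⟧ x ℚ.+ ⟦ q ⟧ x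
⟦⟧-++ []      q x = sym (ℚ.+-identityˡ (⟦ q ⟧ x))
⟦⟧-++ (t ∷ p) q x = trans (cong (evalTerm t x ℚ.+_) (⟦⟧-++ p q x))
                          (sym (ℚ.+-assoc (evalTerm t x) (⟦ p ⟧ x) (⟦ q ⟧ x)))

_·ₜ_ : ∀ {n} → Term n → Term n → Term n
(a , g) ·ₜ (b , h) = a ℚ.* b , g ++ h

_·_ : ∀ {n} → AndSum n → AndSum n → AndSum n
_·_ = cartesianProductWith _·ₜ_

evalTerm-· : ∀ {n} (s t : Term n) x → evalTerm (s ·ₜ t) x ≡ evalTerm s x ℚ.* evalTerm t x
evalTerm-· (a , g) (b , h) x = begin
  (a ℚ.* b) ℚ.* b2q (evalAnd (g ++ h) x)
    ≡⟨ cong (λ c → (a ℚ.* b) ℚ.* b2q c) (evalAnd-++ g h x) ⟩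
  (a ℚ.* b) ℚ.* b2q (evalAnd g x ∧ evalAnd h x)
    ≡⟨ cong ((a ℚ.* b) ℚ.*_) (b2q-∧ (evalAnd g x) (evalAnd h x)) ⟩
  (a ℚ.* b) ℚ.* (b2q (evalAnd g x) ℚ.* b2q (evalAnd h x))
    ≡⟨ interchange a b _ _ ⟩
  (a ℚ.* b2q (evalAnd g x)) ℚ.* (b ℚ.* b2q (evalAnd h x)) ∎
  where open ≡-Reasoning

⟦⟧-map-· : ∀ {n} (s : Term n) (q : AndSum n) x →
  ⟦ map (s ·ₜ_) q ⟧ x ≡ evalTerm s x ℚ.* ⟦ q ⟧ x
⟦⟧-map-· s []      x = sym (ℚ.*-zeroʳ (evalTerm s x))
⟦⟧-map-· s (t ∷ q) x = begin
  evalTerm (s ·ₜ t) x ℚ.+ ⟦ map (s ·ₜ_) q ⟧ x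
    ≡⟨ cong₂ ℚ._+_ (evalTerm-· s t x) (⟦⟧-map-· s q x) ⟩
  evalTerm s x ℚ.* evalTerm t x ℚ.+ evalTerm s x ℚ.* ⟦ q ⟧ x
    ≡⟨ sym (ℚ.*-distribˡ-+ (evalTerm s x) (evalTerm t x) (⟦ q ⟧ x)) ⟩
  evalTerm s x ℚ.* (evalTerm t x ℚ.+ ⟦ q ⟧ x) ∎
  where open ≡-Reasoning

⟦⟧-· : ∀ {n} (p q : AndSum n) x → ⟦ p · q ⟧ x ≡ ⟦ p ⟧ x ℚ.* ⟦ q ⟧ x
⟦⟧-· []      q x = sym (ℚ.*-zeroˡ (⟦ q ⟧ x))
⟦⟧-· (s ∷ p) q x = begin
  ⟦ map (s ·ₜ_) q ++ p · q ⟧ x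
    ≡⟨ ⟦⟧-++ (map (s ·ₜ_) q) (p · q) x ⟩
  ⟦ map (s ·ₜ_) q ⟧ x ℚ.+ ⟦ p · q ⟧ x
    ≡⟨ cong₂ ℚ._+_ (⟦⟧-map-· s q x) (⟦⟧-· p q x) ⟩
  evalTerm s x ℚ.* ⟦ q ⟧ x ℚ.+ ⟦ p ⟧ x ℚ.* ⟦ q ⟧ x
    ≡⟨ sym (ℚ.*-distribʳ-+ (⟦ q ⟧ x) (evalTerm s x) (⟦ p ⟧ x)) ⟩
  (evalTerm s x ℚ.+ ⟦ p ⟧ x) ℚ.* ⟦ q ⟧ x ∎
  where open ≡-Reasoning

rename : ∀ {m n} → (Fin m → Fin n) → AndSum m → AndSum n
rename ρ = map (map₂ (renameGate ρ))

⟦⟧-rename : ∀ {m n} (ρ : Fin m → Fin n) p x → ⟦ rename ρ p ⟧ x ≡ ⟦ p ⟧ (x ∘ ρ)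
⟦⟧-rename ρ []            x = refl
⟦⟧-rename ρ ((w , g) ∷ p) x =
  cong₂ (λ b r → w ℚ.* b2q b ℚ.+ r) (evalAnd-renameGate ρ g x) (⟦⟧-rename ρ p x)

_⊗_ : ∀ {k m} → AndSum k → AndSum m → AndSum (k + m)
_⊗_ {k} {m} p q = rename (_↑ˡ m) p · rename (k ↑ʳ_) q

⟦⟧-⊗ : ∀ {k m} (p : AndSum k) (q : AndSum m) x →
  ⟦ p ⊗ q ⟧ x ≡ ⟦ p ⟧ (x ∘ (_↑ˡ m)) ℚ.* ⟦ q ⟧ (x ∘ (k ↑ʳ_))
⟦⟧-⊗ {k} {m} p q x = trans (⟦⟧-· (rename (_↑ˡ m) p) (rename (k ↑ʳ_) q) x)
                           (cong₂ ℚ._*_ (⟦⟧-rename (_↑ˡ m) p x) (⟦⟧-rename (k ↑ʳ_) q x))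

length-⊗ : ∀ {k m} (p : AndSum k) (q : AndSum m) → length (p ⊗ q) ≡ length p * length q
length-⊗ {k} {m} p q = begin
  length (rename (_↑ˡ m) p · rename (k ↑ʳ_) q)
    ≡⟨ length-cartesianProductWith _·ₜ_ (rename (_↑ˡ m) p) (rename (k ↑ʳ_) q) ⟩
  length (rename (_↑ˡ m) p) * length (rename (k ↑ʳ_) q)
    ≡⟨ cong₂ _*_ (length-map _ p) (length-map _ q) ⟩
  length p * length q ∎
  where open ≡-Reasoning

-- true ↦ −1, matching Computes, where output 1 means a negative linear form.
sign : Bool → ℚ
sign false = 1ℚ
sign true  = ℚ.- 1ℚ

sign-xor : ∀ a b → sign (a xor b) ≡ sign a ℚ.* sign b
sign-xor true  true  = refl
sign-xor true  false = refl
sign-xor false true  = refl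
sign-xor false false = refl

parity-+ : ∀ k m (x : Input (k + m)) →
  parity (k + m) x ≡ parity k (x ∘ (_↑ˡ m)) xor parity m (x ∘ (k ↑ʳ_))
parity-+ ℕ.zero    m x = refl
parity-+ (ℕ.suc k) m x = trans (cong (x zero xor_) (parity-+ k m (x ∘ suc)))
                               (sym (xor-assoc (x zero) _ _))

SignsParity : ∀ {n} → AndSum n → Set
SignsParity {n} p = ∀ x → ⟦ p ⟧ x ≡ sign (parity n x)

⊗-signsParity : ∀ {k m} (p : AndSum k) (q : AndSum m) →
  SignsParity p → SignsParity q → SignsParity (p ⊗ q)
⊗-signsParity {k} {m} p q p± q± x = begin
  ⟦ p ⊗ q ⟧ x
    ≡⟨ ⟦⟧-⊗ p q x ⟩
  ⟦ p ⟧ (x ∘ (_↑ˡ m)) ℚ.* ⟦ q ⟧ (x ∘ (k ↑ʳ_))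
    ≡⟨ cong₂ ℚ._*_ (p± (x ∘ (_↑ˡ m))) (q± (x ∘ (k ↑ʳ_))) ⟩
  sign (parity k (x ∘ (_↑ˡ m))) ℚ.* sign (parity m (x ∘ (k ↑ʳ_)))
    ≡⟨ sym (sign-xor (parity k (x ∘ (_↑ˡ m))) (parity m (x ∘ (k ↑ʳ_)))) ⟩
  sign (parity k (x ∘ (_↑ˡ m)) xor parity m (x ∘ (k ↑ʳ_)))
    ≡⟨ cong sign (sym (parity-+ k m x)) ⟩
  sign (parity (k + m) x) ∎
  where open ≡-Reasoning

-2ℚ : ℚ
-2ℚ = ℚ.- (+ 2 ℚ./ 1)

parity₀ : AndSum 0
parity₀ = (1ℚ , []) ∷ []

parity₁ : AndSum 1
parity₁ = (1ℚ , []) ∷ (-2ℚ , (zero , true) ∷ []) ∷ []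

parity₃ : AndSum 3
parity₃ = (1ℚ , [])
        ∷ (-2ℚ , (x₀ , true)  ∷ (x₁ , false) ∷ (x₂ , false) ∷ [])
        ∷ (-2ℚ , (x₀ , false) ∷ (x₁ , true)  ∷ (x₂ , false) ∷ [])
        ∷ (-2ℚ , (x₀ , false) ∷ (x₁ , false) ∷ (x₂ , true)  ∷ [])
        ∷ (-2ℚ , (x₀ , true)  ∷ (x₁ , true)  ∷ (x₂ , true)  ∷ [])
        ∷ []
  where
  x₀ x₁ x₂ : Fin 3
  x₀ = zero
  x₁ = suc zero
  x₂ = suc (suc zero)

signsParity₀ : SignsParity parity₀
signsParity₀ x = refl

signsParity₁ : SignsParity parity₁
signsParity₁ x with x zero
... | true  = refl
... | false = refl

signsParity₃ : SignsParity parity₃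
signsParity₃ x with x zero | x (suc zero) | x (suc (suc zero))
... | true  | true  | true  = refl
... | true  | true  | false = refl
... | true  | false | true  = refl
... | true  | false | false = refl
... | false | true  | true  = refl
... | false | true  | false = refl
... | false | false | true  = refl
... | false | false | false = refl

parityAndSum : ∀ n → AndSum n
parityAndSum 0 = parity₀
parityAndSum 1 = parity₁
parityAndSum 2 = parity₁ ⊗ parity₁
parityAndSum (ℕ.suc (ℕ.suc (ℕ.suc n))) = parity₃ ⊗ parityAndSum n

signsParity-parityAndSum : ∀ n → SignsParity (parityAndSum n)
signsParity-parityAndSum 0 = signsParity₀
signsParity-parityAndSum 1 = signsParity₁
signsParity-parityAndSum 2 = ⊗-signsParity parity₁ parity₁ signsParity₁ signsParity₁
signsParity-parityAndSum (ℕ.suc (ℕ.suc (ℕ.suc n))) =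
  ⊗-signsParity parity₃ (parityAndSum n) signsParity₃ (signsParity-parityAndSum n)

length-parityAndSum : ∀ n → length (parityAndSum n) ≤ 4 * 5 ^ (n / 3)
length-parityAndSum 0 = s≤s z≤n
length-parityAndSum 1 = s≤s (s≤s z≤n)
length-parityAndSum 2 = ℕ.≤-refl
length-parityAndSum (ℕ.suc (ℕ.suc (ℕ.suc n))) = begin
  length (parity₃ ⊗ parityAndSum n) ≡⟨ length-⊗ parity₃ (parityAndSum n) ⟩
  5 * length (parityAndSum n)       ≤⟨ ℕ.*-monoʳ-≤ 5 (length-parityAndSum n) ⟩
  5 * (4 * 5 ^ (n / 3))             ≡⟨ x∙yz≈y∙xz 5 4 (5 ^ (n / 3)) ⟩
  4 * 5 ^ (1 + n / 3)               ≡⟨ cong (λ e → 4 * 5 ^ e) (sym (m/n≡1+[m∸n]/n {3 + n} 3≤3+n)) ⟩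
  4 * 5 ^ ((3 + n) / 3)             ∎
  where
  open ℕ.≤-Reasoning
  open import Algebra.Properties.CommutativeSemigroup ℕ.*-commutativeSemigroup using (x∙yz≈y∙xz)
  3≤3+n : 3 ≤ 3 + n
  3≤3+n = ℕ.m≤m+n 3 n

threshold : ∀ {n} → AndSum n → ThrAnd n
threshold p = record { size = length p ; gates = proj₂ ∘ lookup p ; w0 = 0ℚ ; w = proj₁ ∘ lookup p }

sumFin-lookup : ∀ {n} (p : AndSum n) x → sumFin (length p) (λ t → evalTerm (lookup p t) x) ≡ ⟦ p ⟧ x
sumFin-lookup []      x = refl
sumFin-lookup (t ∷ p) x = cong (evalTerm t x ℚ.+_) (sumFin-lookup p x)

linForm-threshold : ∀ {n} (p : AndSum n) x → linForm (threshold p) x ≡ ⟦ p ⟧ x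
linForm-threshold p x = trans (ℚ.+-identityˡ _) (sumFin-lookup p x)

computes-sign : ∀ {n} (C : ThrAnd n) (f : Input n → Bool) →
  (∀ x → linForm C x ≡ sign (f x)) → Computes C f
computes-sign C f linForm≡sign x rewrite linForm≡sign x with f x
... | true  = (λ _ → ℚ.negative⁻¹ _) , (λ ())
... | false = (λ ()) , (λ _ → ℚ.positive⁻¹ _)

proposition6p5 : Σ ℕ λ c → Σ ℕ λ n₀ → (n : ℕ) → n₀ ≤ n →
    Σ (ThrAnd n) λ C → Computes C (parity n) × size C ≤ c * 5 ^ (n / 3)
proposition6p5 = 4 , 0 , λ n _ →
  threshold (parityAndSum n) ,
  computes-sign (threshold (parityAndSum n)) (parity n)
    (λ x → trans (linForm-threshold (parityAndSum n) x) (signsParity-parityAndSum n x)) ,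
  length-parityAndSum n
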